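{- Let $Q^*\subseteq Q^{**}$ be finite bounded quasisemilattices such that the inclusion $Q^*\hookrightarrow Q^{**}$ is a bqsl embedding. Then there is a sequence $Q^*=Q_0\subseteq Q_1\subseteq\cdots\subseteq Q_m=Q^{**}$ such that each $Q_i$ (with the induced order) is a bounded quasisemilattice, $|Q_{i+1}|=|Q_i|+1$ for each $i<m$, and each inclusion $Q_i\hookrightarrow Q_{i+1}$ is a bqsl embedding.
   Context: A quasisemilattice (qsl) is a poset $P$ such that for any $p,q\in P$ the set of common lower bounds $\{r: r\leq p, r\leq q\}$ has only finitely many maximal elements and every common lower bound lies below at least one of these maximal elements. A qsl is bounded (a bqsl) if it has a minimum element. A bqsl embedding $f:Q_1\to Q_2$ is an order-embedding that maps the minimum to the minimum and such that for all $p,q\in Q_1$ the maximal common lower bounds of $f(p),f(q)$ in $Q_2$ are exactly the images under $f$ of the maximal common lower bounds of $p,q$ in $Q_1$. -}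

module Defs where

open import Data.Nat using (ℕ)
open import Data.Fin using (Fin)
open import Data.Fin.Subset using (Subset; _∈_)
open import Data.List using (List)
import Data.List.Membership.Propositional as LM
open import Data.Product using (Σ; ∃; _×_)
open import Function.Bundles using (_⇔_)
open import Relation.Binary.PropositionalEquality using (_≡_)

-- Throughout: a finite poset is given on carrier Fin n by a relation _≤_
-- (assumed a decidable partial order in the statement).  Subsets S of
-- Fin n carry the induced order.

module _ {n : ℕ} (_≤_ : Fin n → Fin n → Set) where

  CLB : Subset n → Fin n → Fin n → Fin n → Set
  CLB S p q r = r ∈ S × r ≤ p × r ≤ q

  MCLB : Subset n → Fin n → Fin n → Fin n → Set
  MCLB S p q r = CLB S p q r × (∀ r′ → CLB S p q r′ → r ≤ r′ → r′ ≡ r)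

  IsQSL : Subset n → Set
  IsQSL S = ∀ p q → p ∈ S → q ∈ S →
      (Σ (List (Fin n)) λ L → ∀ r → MCLB S p q r → LM._∈_ r L)
    × (∀ r → CLB S p q r → ∃ λ r′ → MCLB S p q r′ × r ≤ r′)

  IsMin : Subset n → Fin n → Set
  IsMin S m = m ∈ S × (∀ x → x ∈ S → m ≤ x)

  IsBQSL : Subset n → Set
  IsBQSL S = IsQSL S × ∃ λ m → IsMin S m

  -- for S ⊆ T, the inclusion S ↪ T is a bqsl embedding
  -- (it is automatically an order-embedding, as both carry the induced order)
  IsBQSLEmbedding : Subset n → Subset n → Set
  IsBQSLEmbedding S T =
      (∀ m → IsMin S m → IsMin T m)
    × (∀ p q → p ∈ S → q ∈ S → ∀ r → MCLB T p q r ⇔ MCLB S p q r)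

{-# OPTIONS --safe #-}
module Submission where

-- Over a finite poset with decidable order every subset is a quasisemilattice,
-- so only the embedding conditions matter.  Call S closed if it contains the
-- bottom b and all maximal common lower bounds, taken in the whole poset, of
-- any two of its elements.  For closed S these are exactly the maximal common
-- lower bounds inside S, so closed sets are bqsls and inclusions between them
-- are bqsl embeddings; Q* is closed because Q* ↪ Q** is an embedding.  Adding
-- to a closed S a minimal element x of its complement keeps it closed: a new
-- maximal common lower bound r ∉ S of p and q forces p = x or q = x, so r ⊑ x
-- and r = x by minimality.  Repeating until nothing is missing gives the chain.

open import Defs
open import Level using (Level; _⊔_; 0ℓ)
open import Data.Nat using (ℕ; zero; suc; _+_; _∸_; _<_; _≤_; s≤s)
open import Data.Nat.Properties using (m≤n+m; +-suc; m∸n+n≡m; <⇒≤)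
open import Data.Fin using (Fin; zero; suc; _≟_)
open import Data.Fin.Properties using (any?)
open import Data.Fin.Induction using (po-noetherian)
open import Data.Fin.Subset using (Subset; _⊆_; ⊤; ∣_∣; _∈_; _∉_; _∪_; ⁅_⁆; inside; outside)
open import Data.Fin.Subset.Properties
  using ( _∈?_; ∈⊤; drop-there; ∣p∣≡n⇒p≡⊤; ∣p∣≤n; x∈⁅x⁆; x∈⁅y⁆⇒x≡y
        ; q⊆p∪q; x∈p∪q⁺; x∈p∪q⁻; ∪-identityˡ)
open import Data.List using (allFin)
open import Data.List.Membership.Propositional.Properties using (∈-allFin)
open import Data.Vec using (_∷_; here; there)
open import Data.Product using (Σ; ∃; _×_; _,_; proj₁; proj₂)
open import Data.Sum using (inj₁; inj₂)
open import Function using (flip; _∘_; _⇔_; mk⇔; Equivalence)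
open import Induction.WellFounded using (Acc; acc)
open import Relation.Binary.Core using (Rel)
open import Relation.Binary.Definitions using (Decidable)
open import Relation.Binary.Structures using (IsPartialOrder)
open import Relation.Binary.PropositionalEquality using (_≡_; refl; sym; trans; subst; cong)
import Relation.Binary.Construct.Flip.EqAndOrd as Flip
import Relation.Binary.Construct.NonStrictToStrict as ToStrict
open import Relation.Nullary using (yes; no; ¬?; contradiction)
open import Relation.Nullary.Decidable using (_×-dec_)
import Relation.Unary as U

private
  variable
    n : ℕ
    ℓ ℓ′ : Level

∣⁅x⁆∪p∣≡1+∣p∣ : ∀ {x} (p : Subset n) → x ∉ p → ∣ ⁅ x ⁆ ∪ p ∣ ≡ suc ∣ p ∣
∣⁅x⁆∪p∣≡1+∣p∣ {x = zero}  (outside ∷ p) _   = cong (suc ∘ ∣_∣) (∪-identityˡ p)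
∣⁅x⁆∪p∣≡1+∣p∣ {x = zero}  (inside ∷ p)  x∉p = contradiction here x∉p
∣⁅x⁆∪p∣≡1+∣p∣ {x = suc x} (outside ∷ p) x∉p = ∣⁅x⁆∪p∣≡1+∣p∣ p (x∉p ∘ there)
∣⁅x⁆∪p∣≡1+∣p∣ {x = suc x} (inside ∷ p)  x∉p = cong suc (∣⁅x⁆∪p∣≡1+∣p∣ p (x∉p ∘ there))

∣p∣<n⇒∃∉ : (p : Subset n) → ∣ p ∣ < n → ∃ λ x → x ∉ p
∣p∣<n⇒∃∉ (outside ∷ p) _        = zero , λ ()
∣p∣<n⇒∃∉ (inside ∷ p)  (s≤s lt) = let x , x∉p = ∣p∣<n⇒∃∉ p lt in suc x , x∉p ∘ drop-there

Maximal : Rel (Fin n) ℓ → U.Pred (Fin n) ℓ′ → U.Pred (Fin n) (ℓ ⊔ ℓ′)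
Maximal _⊑_ P y = P y × (∀ z → P z → y ⊑ z → z ≡ y)

Minimal : Rel (Fin n) ℓ → U.Pred (Fin n) ℓ′ → U.Pred (Fin n) (ℓ ⊔ ℓ′)
Minimal _⊑_ = Maximal (flip _⊑_)

-- Strictly ascending chains in a finite poset are finite, so climbing through
-- strictly larger elements of P ends at a maximal one.
maximal-above : {_⊑_ : Rel (Fin n) ℓ} → IsPartialOrder _≡_ _⊑_ → Decidable _⊑_ →
                {P : U.Pred (Fin n) ℓ′} → U.Decidable P →
                ∀ {x} → P x → ∃ λ y → Maximal _⊑_ P y × x ⊑ y
maximal-above {n = n} {ℓ = ℓ} {_⊑_ = _⊑_} isPO _⊑?_ {P} P? Px = climb (po-noetherian isPO _) Px
  where
  open IsPartialOrder isPO using () renaming (refl to ⊑-refl; trans to ⊑-trans)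

  _⊏_ : Rel (Fin n) ℓ
  _⊏_ = ToStrict._<_ _≡_ _⊑_

  _⊏?_ : Decidable _⊏_
  _⊏?_ = ToStrict.<-decidable _≡_ _⊑_ _≟_ _⊑?_

  climb : ∀ {x} → Acc (flip _⊏_) x → P x → ∃ λ y → Maximal _⊑_ P y × x ⊑ y
  climb {x} (acc larger) Px with any? (λ y → P? y ×-dec x ⊏? y)
  ... | yes (y , Py , x⊏y) =
    let z , z-max , y⊑z = climb (larger x⊏y) Py in z , z-max , ⊑-trans (proj₁ x⊏y) y⊑z
  ... | no none-above = x , (Px , x-max) , ⊑-refl
    where
    x-max : ∀ z → P z → x ⊑ z → z ≡ x
    x-max z Pz x⊑z with z ≟ x
    ... | yes z≡x = z≡x
    ... | no z≢x  = contradiction (z , Pz , x⊑z , z≢x ∘ sym) none-above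

minimal-below : {_⊑_ : Rel (Fin n) ℓ} → IsPartialOrder _≡_ _⊑_ → Decidable _⊑_ →
                {P : U.Pred (Fin n) ℓ′} → U.Decidable P →
                ∀ {x} → P x → ∃ λ y → Minimal _⊑_ P y × y ⊑ x
minimal-below isPO _⊑?_ = maximal-above (Flip.isPartialOrder isPO) (flip _⊑?_)

module FinitePoset {_⊑_ : Rel (Fin n) 0ℓ} (isPO : IsPartialOrder _≡_ _⊑_) (_⊑?_ : Decidable _⊑_)
  where

  open IsPartialOrder isPO using () renaming (trans to ⊑-trans; antisym to ⊑-antisym)

  CLB? : ∀ S x y → U.Decidable (CLB _⊑_ S x y)
  CLB? S x y r = r ∈? S ×-dec (r ⊑? x ×-dec r ⊑? y)

  finite⇒IsQSL : ∀ S → IsQSL _⊑_ S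
  finite⇒IsQSL S x y _ _ =
    (allFin n , λ r _ → ∈-allFin r) , λ r → maximal-above isPO _⊑?_ (CLB? S x y)

  module MCLBClosure {b} (b-min : IsMin _⊑_ ⊤ b) where

    MCLB-Closed : Subset n → Set
    MCLB-Closed S = b ∈ S × (∀ {x y} → x ∈ S → y ∈ S → ∀ {r} → MCLB _⊑_ ⊤ x y r → r ∈ S)

    -- A common lower bound that is maximal in S is maximal in the whole poset,
    -- since the maximal bound above it in the whole poset lies in S again.
    MCLB-Closed⇒MCLB⇔ : ∀ {S} → MCLB-Closed S → ∀ {x y} → x ∈ S → y ∈ S →
                         ∀ r → MCLB _⊑_ ⊤ x y r ⇔ MCLB _⊑_ S x y r
    MCLB-Closed⇒MCLB⇔ {S} (_ , closed) {x} {y} x∈S y∈S r = mk⇔ restrict extend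
      where
      restrict : MCLB _⊑_ ⊤ x y r → MCLB _⊑_ S x y r
      restrict r-max@((_ , r⊑x , r⊑y) , r-max⊤) =
        (closed x∈S y∈S r-max , r⊑x , r⊑y) , λ r′ (_ , r′-lb) → r-max⊤ r′ (∈⊤ , r′-lb)

      extend : MCLB _⊑_ S x y r → MCLB _⊑_ ⊤ x y r
      extend ((_ , r⊑x , r⊑y) , r-maxS) = (∈⊤ , r⊑x , r⊑y) , r-max⊤
        where
        r-max⊤ : ∀ r′ → CLB _⊑_ ⊤ x y r′ → r ⊑ r′ → r′ ≡ r
        r-max⊤ r′ r′-lb r⊑r′ =
          let r″ , r″-max , r′⊑r″ = maximal-above isPO _⊑?_ (CLB? ⊤ x y) r′-lb
              r″≡r = r-maxS r″ (closed x∈S y∈S r″-max , proj₂ (proj₁ r″-max)) (⊑-trans r⊑r′ r′⊑r″)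
          in ⊑-antisym (subst (r′ ⊑_) r″≡r r′⊑r″) r⊑r′

    MCLB-Closed⇒IsBQSL : ∀ {S} → MCLB-Closed S → IsBQSL _⊑_ S
    MCLB-Closed⇒IsBQSL {S} (b∈S , _) = finite⇒IsQSL S , b , b∈S , λ x _ → proj₂ b-min x ∈⊤

    MCLB-Closed⇒IsBQSLEmbedding : ∀ {S T} → MCLB-Closed S → MCLB-Closed T → S ⊆ T →
                                  IsBQSLEmbedding _⊑_ S T
    MCLB-Closed⇒IsBQSLEmbedding {S} {T} cS@(b∈S , _) cT@(b∈T , _) S⊆T =
      min-preserved , same-mclbs
      where
      min-preserved : ∀ m → IsMin _⊑_ S m → IsMin _⊑_ T m
      min-preserved m (_ , m-min) with ⊑-antisym (m-min b b∈S) (proj₂ b-min m ∈⊤)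
      ... | refl = b∈T , λ x _ → proj₂ b-min x ∈⊤

      same-mclbs : ∀ x y → x ∈ S → y ∈ S → ∀ r → MCLB _⊑_ T x y r ⇔ MCLB _⊑_ S x y r
      same-mclbs x y x∈S y∈S r =
        let viaS = MCLB-Closed⇒MCLB⇔ cS x∈S y∈S r
            viaT = MCLB-Closed⇒MCLB⇔ cT (S⊆T x∈S) (S⊆T y∈S) r
        in mk⇔ (Equivalence.to viaS ∘ Equivalence.from viaT)
               (Equivalence.to viaT ∘ Equivalence.from viaS)

    IsBQSLEmbedding⇒MCLB-Closed : ∀ {S} → b ∈ S → IsBQSLEmbedding _⊑_ S ⊤ → MCLB-Closed S
    IsBQSLEmbedding⇒MCLB-Closed b∈S (_ , same-mclbs) =
      b∈S , λ {x} {y} x∈S y∈S {r} r-max →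
        proj₁ (proj₁ (Equivalence.to (same-mclbs x y x∈S y∈S r) r-max))

    MCLB-Closed-∪-minimal : ∀ {S x} → MCLB-Closed S → Minimal _⊑_ (_∉ S) x →
                            MCLB-Closed (⁅ x ⁆ ∪ S)
    MCLB-Closed-∪-minimal {S} {x} (b∈S , closed) (_ , x-min) = q⊆p∪q ⁅ x ⁆ S b∈S , closed′
      where
      new : ∀ {r} → r ∉ S → r ⊑ x → r ∈ ⁅ x ⁆ ∪ S
      new {r} r∉S r⊑x = x∈p∪q⁺ (inj₁ (subst (_∈ ⁅ x ⁆) (sym (x-min r r∉S r⊑x)) (x∈⁅x⁆ x)))

      closed′ : ∀ {y z} → y ∈ ⁅ x ⁆ ∪ S → z ∈ ⁅ x ⁆ ∪ S →
                ∀ {r} → MCLB _⊑_ ⊤ y z r → r ∈ ⁅ x ⁆ ∪ S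
      closed′ {y} {z} y∈ z∈ {r} r-max@((_ , r⊑y , r⊑z) , _) with r ∈? S
      ... | yes r∈S = q⊆p∪q ⁅ x ⁆ S r∈S
      ... | no r∉S with x∈p∪q⁻ ⁅ x ⁆ S y∈ | x∈p∪q⁻ ⁅ x ⁆ S z∈
      ...   | inj₁ y∈⁅x⁆ | _         = new r∉S (subst (r ⊑_) (x∈⁅y⁆⇒x≡y x y∈⁅x⁆) r⊑y)
      ...   | inj₂ _     | inj₁ z∈⁅x⁆ = new r∉S (subst (r ⊑_) (x∈⁅y⁆⇒x≡y x z∈⁅x⁆) r⊑z)
      ...   | inj₂ y∈S   | inj₂ z∈S  = contradiction (closed y∈S z∈S r-max) r∉S

    record ClosedChain (S : Subset n) : Set where
      field
        length    : ℕ
        Q         : ℕ → Subset n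
        Q0≡S      : Q 0 ≡ S
        Qlength≡⊤ : Q length ≡ ⊤
        closed    : ∀ i → i ≤ length → MCLB-Closed (Q i)
        step-⊆    : ∀ i → i < length → Q i ⊆ Q (suc i)
        step-size : ∀ i → i < length → ∣ Q (suc i) ∣ ≡ suc ∣ Q i ∣

    prepend : ∀ {S T} → MCLB-Closed S → S ⊆ T → ∣ T ∣ ≡ suc ∣ S ∣ → ClosedChain T → ClosedChain S
    prepend {S} {T} cS S⊆T ∣T∣≡1+∣S∣ chain = record
      { length    = suc length
      ; Q         = Q′
      ; Q0≡S      = refl
      ; Qlength≡⊤ = Qlength≡⊤
      ; closed    = closed′
      ; step-⊆    = step-⊆′
      ; step-size = step-size′
      }
      where
      open ClosedChain chain

      Q′ : ℕ → Subset n
      Q′ zero    = S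
      Q′ (suc i) = Q i

      closed′ : ∀ i → i ≤ suc length → MCLB-Closed (Q′ i)
      closed′ zero    _         = cS
      closed′ (suc i) (s≤s i≤l) = closed i i≤l

      step-⊆′ : ∀ i → i < suc length → Q′ i ⊆ Q′ (suc i)
      step-⊆′ zero    _         = subst (S ⊆_) (sym Q0≡S) S⊆T
      step-⊆′ (suc i) (s≤s i<l) = step-⊆ i i<l

      step-size′ : ∀ i → i < suc length → ∣ Q′ (suc i) ∣ ≡ suc ∣ Q′ i ∣
      step-size′ zero    _         = trans (cong ∣_∣ Q0≡S) ∣T∣≡1+∣S∣
      step-size′ (suc i) (s≤s i<l) = step-size i i<l

    closedChain : ∀ k {S} → k + ∣ S ∣ ≡ n → MCLB-Closed S → ClosedChain S
    closedChain zero    {S} ∣S∣≡n cS = record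
      { length    = 0
      ; Q         = λ _ → S
      ; Q0≡S      = refl
      ; Qlength≡⊤ = ∣p∣≡n⇒p≡⊤ ∣S∣≡n
      ; closed    = λ _ _ → cS
      ; step-⊆    = λ _ ()
      ; step-size = λ _ ()
      }
    closedChain (suc k) {S} k+∣S∣≡n cS
      with ∣p∣<n⇒∃∉ S (subst (∣ S ∣ <_) k+∣S∣≡n (s≤s (m≤n+m ∣ S ∣ k)))
    ... | _ , x₀∉S with minimal-below isPO _⊑?_ (¬? ∘ (_∈? S)) x₀∉S
    ...   | x , x-min@(x∉S , _) , _ =
      prepend cS (q⊆p∪q ⁅ x ⁆ S) ∣S∪x∣≡1+∣S∣
        (closedChain k (trans (cong (k +_) ∣S∪x∣≡1+∣S∣) (trans (+-suc k ∣ S ∣) k+∣S∣≡n))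
                       (MCLB-Closed-∪-minimal cS x-min))
      where
      ∣S∪x∣≡1+∣S∣ : ∣ ⁅ x ⁆ ∪ S ∣ ≡ suc ∣ S ∣
      ∣S∪x∣≡1+∣S∣ = ∣⁅x⁆∪p∣≡1+∣p∣ S x∉S

mainTheorem8 : (n : ℕ) (_⊑_ : Rel (Fin n) _) → IsPartialOrder _≡_ _⊑_ → Decidable _⊑_ →
  IsBQSL _⊑_ ⊤ → (Qs : Subset n) → IsBQSL _⊑_ Qs → IsBQSLEmbedding _⊑_ Qs ⊤ →
  Σ ℕ λ m → Σ (ℕ → Subset n) λ Q →
      Q 0 ≡ Qs
    × Q m ≡ ⊤
    × (∀ i → i ≤ m → IsBQSL _⊑_ (Q i))
    × (∀ i → i < m → Q i ⊆ Q (suc i))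
    × (∀ i → i < m → ∣ Q (suc i) ∣ ≡ suc ∣ Q i ∣)
    × (∀ i → i < m → IsBQSLEmbedding _⊑_ (Q i) (Q (suc i)))
mainTheorem8 n _⊑_ isPO _⊑?_ _ Qs (_ , b , b∈Qs , b-min-Qs) emb@(min-preserved , _) =
  length , Q , Q0≡S , Qlength≡⊤
  , (λ i i≤l → MCLB-Closed⇒IsBQSL (closed i i≤l))
  , step-⊆ , step-size
  , λ i i<l → MCLB-Closed⇒IsBQSLEmbedding (closed i (<⇒≤ i<l)) (closed (suc i) i<l) (step-⊆ i i<l)
  where
  b-min : IsMin _⊑_ ⊤ b
  b-min = min-preserved b (b∈Qs , b-min-Qs)

  open FinitePoset isPO _⊑?_
  open MCLBClosure b-min

  chain : ClosedChain Qs
  chain = closedChain (n ∸ ∣ Qs ∣) (m∸n+n≡m (∣p∣≤n Qs)) (IsBQSLEmbedding⇒MCLB-Closed b∈Qs emb)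

  open ClosedChain chain
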